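{- Let $Z$ be a finite set, and let $M\in\mathbf P(Z)^{k\times\ell}$ and $M'\in\mathbf P(Z)^{k'\times\ell}$ be matrices whose entries are subsets of $Z$, with $k\ge k'$. Assume the rows of $M$ are pairwise distinct and the rows of $M'$ are pairwise distinct, and moreover: (1) for every $i\in[k]$ there is $i'\in[k']$ such that $M'_{i',j}\subseteq M_{i,j}$ for all $j\in[\ell]$; (2) for every $i'\in[k']$ there is $i\in[k]$ such that row $i'$ of $M'$ equals row $i$ of $M$. Then $L(M)=L(M')$ and $CC(M)=CC(M')$.
   Context: $\mathbf P(Z)$ is the power set of $Z$. A matrix $N$ with entries in $\mathbf P(Z)$ defines a communication problem: Alice receives a row index $i$, Bob receives a column index $j$, and they must output some $z\in N_{i,j}$ (the $j$-th columns of $M$ and $M'$ correspond to the same Bob input index). $CC(N)$ is the minimum, over deterministic protocols solving this problem, of the worst-case number of bits communicated; $L(N)$ is the minimum number of leaves of a protocol tree solving it. -}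

module Defs where

open import Data.Nat using (ℕ; zero; suc; _+_; _≤_; _⊔_)
open import Data.Fin using (Fin)
open import Data.Fin.Subset using (Subset; _∈_)
open import Data.Bool using (Bool; true; false; if_then_else_)
open import Data.Product using (Σ; ∃; _×_)
open import Relation.Binary.PropositionalEquality using (_≡_)

-- A matrix in P(Z)^{k×ℓ}, with Z = Fin z (a finite set);
-- subsets of Z are 'Subset z' from Data.Fin.Subset.
Matrix : ℕ → ℕ → ℕ → Set
Matrix z k ℓ = Fin k → Fin ℓ → Subset z

-- Deterministic protocol trees: Alice holds a row index (Fin k),
-- Bob holds a column index (Fin ℓ). Each internal node is owned by one
-- player, who sends one bit computed from their own input (true = go left);
-- leaves are labelled by an output in Z = Fin z.
data Protocol (z k ℓ : ℕ) : Set where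
  leaf  : Fin z → Protocol z k ℓ
  alice : (Fin k → Bool) → Protocol z k ℓ → Protocol z k ℓ → Protocol z k ℓ
  bob   : (Fin ℓ → Bool) → Protocol z k ℓ → Protocol z k ℓ → Protocol z k ℓ

run : ∀ {z k ℓ} → Protocol z k ℓ → Fin k → Fin ℓ → Fin z
run (leaf o)      i j = o
run (alice f p q) i j = if f i then run p i j else run q i j
run (bob g p q)   i j = if g j then run p i j else run q i j

leaves : ∀ {z k ℓ} → Protocol z k ℓ → ℕ
leaves (leaf _)      = 1
leaves (alice _ p q) = leaves p + leaves q
leaves (bob _ p q)   = leaves p + leaves q

-- worst-case number of bits communicated = depth of the tree
depth : ∀ {z k ℓ} → Protocol z k ℓ → ℕ
depth (leaf _)      = 0
depth (alice _ p q) = suc (depth p ⊔ depth q)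
depth (bob _ p q)   = suc (depth p ⊔ depth q)

Solves : ∀ {z k ℓ} → Protocol z k ℓ → Matrix z k ℓ → Set
Solves p N = ∀ i j → run p i j ∈ N i j

IsL : ∀ {z k ℓ} → Matrix z k ℓ → ℕ → Set
IsL {z} {k} {ℓ} N n =
  (Σ (Protocol z k ℓ) λ p → Solves p N × leaves p ≡ n)
  × (∀ (p : Protocol z k ℓ) → Solves p N → n ≤ leaves p)

IsCC : ∀ {z k ℓ} → Matrix z k ℓ → ℕ → Set
IsCC {z} {k} {ℓ} N c =
  (Σ (Protocol z k ℓ) λ p → Solves p N × depth p ≡ c)
  × (∀ (p : Protocol z k ℓ) → Solves p N → c ≤ depth p)

RowsDistinct : ∀ {z k ℓ} → Matrix z k ℓ → Set
RowsDistinct {z} {k} {ℓ} M = ∀ (i₁ i₂ : Fin k) → (∀ j → M i₁ j ≡ M i₂ j) → i₁ ≡ i₂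

{-# OPTIONS --safe #-}
module Submission where

-- Alice can translate her input before running a protocol.  If every row i of M
-- contains, entrywise, some row f i of N, then a protocol for N with Alice's input
-- first mapped by f solves M, and this translation changes neither the shape of
-- the tree nor, therefore, its number of leaves or its depth.  Condition (1) lets
-- protocols for M' solve M and condition (2) lets protocols for M solve M', so
-- both problems admit protocols of exactly the same costs and have the same minima.

open import Defs
open import Data.Nat using (ℕ; suc; _≤_; _+_; _⊔_)
open import Data.Fin using (Fin)
open import Data.Fin.Subset using (_⊆_)
open import Data.Fin.Subset.Properties using (⊆-reflexive)
open import Data.Bool using (true; false)
open import Data.Product using (Σ; _×_; _,_; proj₁; proj₂)
open import Function.Bundles using (_⇔_; mk⇔)
open import Relation.Binary.PropositionalEquality using (_≡_; refl; sym; trans; subst; cong; cong₂)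

module _ {z ℓ : ℕ} where

  reindexAlice : ∀ {k k'} → (Fin k → Fin k') → Protocol z k' ℓ → Protocol z k ℓ
  reindexAlice f (leaf o)      = leaf o
  reindexAlice f (alice g p q) = alice (λ i → g (f i)) (reindexAlice f p) (reindexAlice f q)
  reindexAlice f (bob g p q)   = bob g (reindexAlice f p) (reindexAlice f q)

  run-reindexAlice : ∀ {k k'} (f : Fin k → Fin k') (p : Protocol z k' ℓ) i j →
                     run (reindexAlice f p) i j ≡ run p (f i) j
  run-reindexAlice f (leaf o) i j = refl
  run-reindexAlice f (alice g p q) i j with g (f i)
  ... | true  = run-reindexAlice f p i j
  ... | false = run-reindexAlice f q i j
  run-reindexAlice f (bob g p q) i j with g j
  ... | true  = run-reindexAlice f p i j
  ... | false = run-reindexAlice f q i j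

  leaves-reindexAlice : ∀ {k k'} (f : Fin k → Fin k') (p : Protocol z k' ℓ) →
                        leaves (reindexAlice f p) ≡ leaves p
  leaves-reindexAlice f (leaf o)      = refl
  leaves-reindexAlice f (alice g p q) = cong₂ _+_ (leaves-reindexAlice f p) (leaves-reindexAlice f q)
  leaves-reindexAlice f (bob g p q)   = cong₂ _+_ (leaves-reindexAlice f p) (leaves-reindexAlice f q)

  depth-reindexAlice : ∀ {k k'} (f : Fin k → Fin k') (p : Protocol z k' ℓ) →
                       depth (reindexAlice f p) ≡ depth p
  depth-reindexAlice f (leaf o)      = refl
  depth-reindexAlice f (alice g p q) =
    cong suc (cong₂ _⊔_ (depth-reindexAlice f p) (depth-reindexAlice f q))
  depth-reindexAlice f (bob g p q)   =
    cong suc (cong₂ _⊔_ (depth-reindexAlice f p) (depth-reindexAlice f q))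

  ReducesTo : ∀ {k k'} → Matrix z k ℓ → Matrix z k' ℓ → Set
  ReducesTo {k' = k'} M N = ∀ i → Σ (Fin k') λ i' → ∀ j → N i' j ⊆ M i j

  solves-reindexAlice : ∀ {k k'} {M : Matrix z k ℓ} {N : Matrix z k' ℓ} →
                        (r : ReducesTo M N) (p : Protocol z k' ℓ) →
                        Solves p N → Solves (reindexAlice (λ i → proj₁ (r i)) p) M
  solves-reindexAlice r p sol i j
    rewrite run-reindexAlice (λ i → proj₁ (r i)) p i j = proj₂ (r i) j (sol (proj₁ (r i)) j)

  ReindexInvariant : (∀ {k} → Protocol z k ℓ → ℕ) → Set
  ReindexInvariant μ = ∀ {k k'} (f : Fin k → Fin k') p → μ (reindexAlice f p) ≡ μ p

  -- IsL and IsCC are, definitionally, IsMinimal leaves and IsMinimal depth.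
  IsMinimal : ∀ {k} → (∀ {k} → Protocol z k ℓ → ℕ) → Matrix z k ℓ → ℕ → Set
  IsMinimal {k} μ N n =
    (Σ (Protocol z k ℓ) λ p → Solves p N × μ p ≡ n) × (∀ p → Solves p N → n ≤ μ p)

  module _ {μ : ∀ {k} → Protocol z k ℓ → ℕ} (invariant : ReindexInvariant μ) where

    isMinimal-transfer : ∀ {k k'} {M : Matrix z k ℓ} {N : Matrix z k' ℓ} →
                         ReducesTo M N → ReducesTo N M →
                         ∀ {n} → IsMinimal μ N n → IsMinimal μ M n
    isMinimal-transfer M→N N→M {n} ((p , sol , cost) , minimal) =
      (reindexAlice fM p , solves-reindexAlice M→N p sol , trans (invariant fM p) cost) ,
      λ q solq → subst (n ≤_) (invariant fN q)
                       (minimal (reindexAlice fN q) (solves-reindexAlice N→M q solq))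
      where
      fM : Fin _ → Fin _
      fM i = proj₁ (M→N i)
      fN : Fin _ → Fin _
      fN i = proj₁ (N→M i)

    isMinimal-⇔ : ∀ {k k'} {M : Matrix z k ℓ} {N : Matrix z k' ℓ} →
                  ReducesTo M N → ReducesTo N M → ∀ n → IsMinimal μ M n ⇔ IsMinimal μ N n
    isMinimal-⇔ M→N N→M n = mk⇔ (isMinimal-transfer N→M M→N) (isMinimal-transfer M→N N→M)

lemma2p21 : (z k k' ℓ : ℕ) (M : Matrix z k ℓ) (M' : Matrix z k' ℓ)
    → k' ≤ k
    → RowsDistinct M
    → RowsDistinct M'
    → (∀ (i : Fin k) → Σ (Fin k') λ i' → ∀ (j : Fin ℓ) → M' i' j ⊆ M i j)
    → (∀ (i' : Fin k') → Σ (Fin k) λ i → ∀ (j : Fin ℓ) → M' i' j ≡ M i j)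
    → (∀ (n : ℕ) → IsL M n ⇔ IsL M' n) × (∀ (c : ℕ) → IsCC M c ⇔ IsCC M' c)
lemma2p21 z k k' ℓ M M' _ _ _ M→M' rowOfM =
  isMinimal-⇔ leaves-reindexAlice M→M' M'→M ,
  isMinimal-⇔ depth-reindexAlice M→M' M'→M
  where
  M'→M : ReducesTo M' M
  M'→M i' = proj₁ (rowOfM i') , λ j → ⊆-reflexive (sym (proj₂ (rowOfM i') j))
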